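{- For all positive integers $c,m,n$ with $m\le n$, the integer $h_c\left(\prod_{\ell=m}^{n}(\ell+\sqrt{ -c})\right)$ divides $c\prod_{\ell=1}^{n-m}(\ell^2+4c)$.
   Context: Here $\sqrt{ -c}=i\sqrt{c}$, and $h_c:\mathbb{Z}[\sqrt{ -c}]\setminus\{0\}\to\mathbb{N}^*$ is the map $a+b\sqrt{ -c}\mapsto\gcd(a,b)$ for $a,b\in\mathbb{Z}$ not both zero. An empty product equals $1$. -}

module Defs where

open import Data.Nat as ℕ using (ℕ; zero; suc)
open import Data.Integer as ℤ using (ℤ; +_; ∣_∣)
open import Data.Nat.GCD using (gcd)
open import Data.Product using (_×_; _,_)

-- An element a + b√-c of ℤ[√-c], represented by the pair (a , b).
ℤ√- : Set
ℤ√- = ℤ × ℤ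

-- Multiplication in ℤ[√-c]:
-- (a + b√-c)(x + y√-c) = (a x - c b y) + (a y + b x)√-c
mul : ℕ → ℤ√- → ℤ√- → ℤ√-
mul c (a , b) (x , y) =
  (a ℤ.* x ℤ.- (+ c) ℤ.* (b ℤ.* y)) , (a ℤ.* y ℤ.+ b ℤ.* x)

h : ℤ√- → ℕ
h (a , b) = gcd ∣ a ∣ ∣ b ∣

-- ∏_{ℓ = m}^{m + k} (ℓ + √-c), computed as ∏ over ℓ = m, m+1, …, m+k.
prodShift : ℕ → ℕ → ℕ → ℤ√-
prodShift c m zero    = (+ m , + 1)
prodShift c m (suc k) = mul c (prodShift c m k) (+ (m ℕ.+ suc k) , + 1)

prodRange : ℕ → ℕ → ℕ → ℤ√-
prodRange c m n = prodShift c m (n ℕ.∸ m)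

prodSq : ℕ → ℕ → ℕ
prodSq c zero    = 1
prodSq c (suc k) = prodSq c k ℕ.* (suc k ℕ.* suc k ℕ.+ 4 ℕ.* c)

module Submission where

-- Put x = m + √-c, k = n - m and u = x + k. The product is the falling factorial
-- P = u↓(k+1), while v = -x̄ has v↓(k+1) = ±P̄. In the Vandermonde expansion
-- (u + v)↓(2k+1) = Σᵢ C(2k+1,i) v↓i u↓(2k+1-i) every term with i ≤ k contains P, so
-- their sum W is divisible by h(P). Since u + v = 2√-c + k, the left-hand side is
-- 2√-c · (-1)^k ∏_{ℓ=1}^{k}(ℓ² + 4c). The reflection symmetry a↓j = (-1)^j (j-1-a)↓j
-- turns the conjugate of W into minus the remaining terms, so the left-hand side is
-- W - W̄ = 2 Im(W)·√-c. Hence Im W = ±∏(ℓ² + 4c), and h(P) divides this product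
-- already without the factor c.

open import Defs
open import Data.Nat.Base as ℕ using (ℕ; zero; suc; _!)
import Data.Nat.Properties as ℕ
import Data.Nat.Tactic.RingSolver as ℕ-Solver
open import Data.Integer.Base as ℤ using (ℤ; +_; +0)
import Data.Integer.Properties as ℤ
open import Data.Integer.Tactic.RingSolver using (solve-∀)
open import Data.Product.Base using (_×_; _,_; proj₂)
open import Data.Nat.GCD using (gcd[m,n]∣m; gcd[m,n]∣n)
import Data.Nat.Divisibility as ℕ
import Data.Integer.Divisibility.Signed as ℤ
open import Data.Maybe.Base as Maybe using (Maybe)
open import Relation.Nullary.Decidable using (dec⇒maybe)
open import Relation.Binary.PropositionalEquality
open import Level using (0ℓ)
open import Algebra.Bundles using (CommutativeRing; Semiring)
open import Algebra.Structures using (IsCommutativeRing)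
open import Algebra.Solver.Ring.AlmostCommutativeRing
  using (AlmostCommutativeRing; fromCommutativeRing; _-Raw-AlmostCommutative⟶_)
import Algebra.Solver.Ring as RingSolver
open ≡-Reasoning

-- binom i j is the binomial coefficient C(i + j, i).
binom : ℕ → ℕ → ℕ
binom zero    j       = 1
binom (suc i) zero    = 1
binom (suc i) (suc j) = binom i (suc j) ℕ.+ binom (suc i) j

binom-sym : ∀ i j → binom i j ≡ binom j i
binom-sym zero    zero    = refl
binom-sym zero    (suc j) = refl
binom-sym (suc i) zero    = refl
binom-sym (suc i) (suc j) =
  trans (cong₂ ℕ._+_ (binom-sym i (suc j)) (binom-sym (suc i) j))
        (ℕ.+-comm (binom (suc j) i) (binom j (suc i)))

binom-factorials : ∀ i j → binom i j ℕ.* (i ! ℕ.* j !) ≡ (i ℕ.+ j) !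
binom-factorials zero    j    = trans (ℕ.*-identityˡ _) (ℕ.*-identityˡ (j !))
binom-factorials (suc i) zero =
  trans (trans (ℕ.*-identityˡ _) (ℕ.*-identityʳ (suc i !))) (cong _! (sym (ℕ.+-identityʳ (suc i))))
binom-factorials (suc i) (suc j) = begin
  (binom i (suc j) ℕ.+ binom (suc i) j) ℕ.* (suc i ! ℕ.* suc j !)
    ≡⟨ regroup i j (binom i (suc j)) (binom (suc i) j) (i !) (j !) ⟩
  suc i ℕ.* (binom i (suc j) ℕ.* (i ! ℕ.* suc j !))
    ℕ.+ suc j ℕ.* (binom (suc i) j ℕ.* (suc i ! ℕ.* j !))
    ≡⟨ cong₂ (λ x y → suc i ℕ.* x ℕ.+ suc j ℕ.* y) (binom-factorials i (suc j)) (binom-factorials (suc i) j) ⟩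
  suc i ℕ.* (i ℕ.+ suc j) ! ℕ.+ suc j ℕ.* suc (i ℕ.+ j) !
    ≡⟨ cong (λ n → suc i ℕ.* n ! ℕ.+ suc j ℕ.* suc (i ℕ.+ j) !) (ℕ.+-suc i j) ⟩
  suc i ℕ.* suc (i ℕ.+ j) ! ℕ.+ suc j ℕ.* suc (i ℕ.+ j) !
    ≡⟨ ℕ.*-distribʳ-+ (suc (i ℕ.+ j) !) (suc i) (suc j) ⟨
  (suc i ℕ.+ suc j) ℕ.* suc (i ℕ.+ j) !
    ≡⟨ cong (λ n → suc n ℕ.* suc (i ℕ.+ j) !) (ℕ.+-suc i j) ⟩
  suc (suc (i ℕ.+ j)) ℕ.* suc (i ℕ.+ j) !
    ≡⟨ cong (λ n → suc n !) (ℕ.+-suc i j) ⟨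
  (suc i ℕ.+ suc j) ! ∎
  where
  regroup : ∀ i j x y u v → (x ℕ.+ y) ℕ.* ((suc i ℕ.* u) ℕ.* (suc j ℕ.* v))
            ≡ suc i ℕ.* (x ℕ.* (u ℕ.* (suc j ℕ.* v))) ℕ.+ suc j ℕ.* (y ℕ.* ((suc i ℕ.* u) ℕ.* v))
  regroup = ℕ-Solver.solve-∀

binom-absorption : ∀ i j → suc i ℕ.* binom (suc i) j ≡ suc j ℕ.* binom i (suc j)
binom-absorption i j = ℕ.*-cancelʳ-≡ _ _ (i ! ℕ.* j !) {{i ℕ.!* j !≢0}} (begin
  suc i ℕ.* binom (suc i) j ℕ.* (i ! ℕ.* j !)   ≡⟨ shuffle i (binom (suc i) j) (i !) (j !) ⟩
  binom (suc i) j ℕ.* (suc i ! ℕ.* j !)         ≡⟨ binom-factorials (suc i) j ⟩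
  suc (i ℕ.+ j) !                               ≡⟨ cong _! (ℕ.+-suc i j) ⟨
  (i ℕ.+ suc j) !                               ≡⟨ binom-factorials i (suc j) ⟨
  binom i (suc j) ℕ.* (i ! ℕ.* suc j !)         ≡⟨ shuffle′ j (binom i (suc j)) (i !) (j !) ⟩
  suc j ℕ.* binom i (suc j) ℕ.* (i ! ℕ.* j !)   ∎)
  where
  shuffle : ∀ i x u v → suc i ℕ.* x ℕ.* (u ℕ.* v) ≡ x ℕ.* ((suc i ℕ.* u) ℕ.* v)
  shuffle = ℕ-Solver.solve-∀
  shuffle′ : ∀ j x u v → x ℕ.* (u ℕ.* (suc j ℕ.* v)) ≡ suc j ℕ.* x ℕ.* (u ℕ.* v)
  shuffle′ = ℕ-Solver.solve-∀

module ComponentIdentities where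

  open import Data.Integer.Base using (_+_; _*_; _-_; -_)

  *-assoc-re : ∀ C a b x y u v → (a * x - C * (b * y)) * u - C * ((a * y + b * x) * v)
      ≡ a * (x * u - C * (y * v)) - C * (b * (x * v + y * u))
  *-assoc-re = solve-∀
  *-assoc-im : ∀ C a b x y u v → (a * x - C * (b * y)) * v + (a * y + b * x) * u
      ≡ a * (x * v + y * u) + b * (x * u - C * (y * v))
  *-assoc-im = solve-∀
  *-identityˡ-re : ∀ C a b → + 1 * a - C * (+0 * b) ≡ a
  *-identityˡ-re = solve-∀
  *-identityˡ-im : ∀ a b → + 1 * b + +0 * a ≡ b
  *-identityˡ-im = solve-∀
  *-identityʳ-re : ∀ C a b → a * + 1 - C * (b * +0) ≡ a
  *-identityʳ-re = solve-∀
  *-identityʳ-im : ∀ a b → a * +0 + b * + 1 ≡ b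
  *-identityʳ-im = solve-∀
  *-distribˡ-re : ∀ C a b x y u v → a * (x + u) - C * (b * (y + v))
      ≡ (a * x - C * (b * y)) + (a * u - C * (b * v))
  *-distribˡ-re = solve-∀
  *-distribˡ-im : ∀ a b x y u v → a * (y + v) + b * (x + u) ≡ (a * y + b * x) + (a * v + b * u)
  *-distribˡ-im = solve-∀
  *-distribʳ-re : ∀ C a b x y u v → (x + u) * a - C * ((y + v) * b)
      ≡ (x * a - C * (y * b)) + (u * a - C * (v * b))
  *-distribʳ-re = solve-∀
  *-distribʳ-im : ∀ a b x y u v → (x + u) * b + (y + v) * a ≡ (x * b + y * a) + (u * b + v * a)
  *-distribʳ-im = solve-∀
  *-comm-re : ∀ C a b x y → a * x - C * (b * y) ≡ x * a - C * (y * b)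
  *-comm-re = solve-∀
  *-comm-im : ∀ a b x y → a * y + b * x ≡ x * b + y * a
  *-comm-im = solve-∀
  embed-*-re : ∀ C x y → x * y ≡ x * y - C * (+0 * +0)
  embed-*-re = solve-∀
  embed-*-im : ∀ x y → +0 ≡ x * +0 + +0 * y
  embed-*-im = solve-∀
  conj-*-re : ∀ C a b x y → a * x - C * (b * y) ≡ a * x - C * (- b * - y)
  conj-*-re = solve-∀
  conj-*-im : ∀ a b x y → - (a * y + b * x) ≡ a * - y + - b * x
  conj-*-im = solve-∀
  sub-conj-im : ∀ b → b + - - b ≡ + 2 * b
  sub-conj-im = solve-∀
  δ-square-re : ∀ C K → (+0 + K) * (+0 + - K) - C * ((+ 2 + +0) * (+ 2 + - +0)) ≡ - (K * K + + 4 * C)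
  δ-square-re = solve-∀
  δ-square-im : ∀ K → (+0 + K) * (+ 2 + - +0) + (+ 2 + +0) * (+0 + - K) ≡ +0
  δ-square-im = solve-∀
  real-*-imaginary-re : ∀ C x y → x * +0 - C * (+0 * y) ≡ +0
  real-*-imaginary-re = solve-∀
  real-*-imaginary-im : ∀ x y → x * (+ 2 * y) + +0 * +0 ≡ + 2 * (x * y)
  real-*-imaginary-im = solve-∀

module ℤ√-Ring (c : ℕ) where

  open ComponentIdentities

  infixl 6 _+_ _-_
  infixl 7 _*_
  infix  8 -_

  _+_ : ℤ√- → ℤ√- → ℤ√-
  (a , b) + (x , y) = (a ℤ.+ x , b ℤ.+ y)

  _*_ : ℤ√- → ℤ√- → ℤ√-
  _*_ = mul c

  -_ : ℤ√- → ℤ√-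
  - (a , b) = (ℤ.- a , ℤ.- b)

  _-_ : ℤ√- → ℤ√- → ℤ√-
  x - y = x + - y

  0# 1# : ℤ√-
  0# = (+0 , +0)
  1# = (+ 1 , +0)

  isCommutativeRing : IsCommutativeRing _≡_ _+_ _*_ -_ 0# 1#
  isCommutativeRing = record
    { isRing = record
      { +-isAbelianGroup = record
        { isGroup = record
          { isMonoid = record
            { isSemigroup = record
              { isMagma = record { isEquivalence = isEquivalence ; ∙-cong = cong₂ _+_ }
              ; assoc   = λ (a , b) (x , y) (u , v) → cong₂ _,_ (ℤ.+-assoc a x u) (ℤ.+-assoc b y v)
              }
            ; identity = (λ (a , b) → cong₂ _,_ (ℤ.+-identityˡ a) (ℤ.+-identityˡ b))
                       , (λ (a , b) → cong₂ _,_ (ℤ.+-identityʳ a) (ℤ.+-identityʳ b))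
            }
          ; inverse = (λ (a , b) → cong₂ _,_ (ℤ.+-inverseˡ a) (ℤ.+-inverseˡ b))
                    , (λ (a , b) → cong₂ _,_ (ℤ.+-inverseʳ a) (ℤ.+-inverseʳ b))
          ; ⁻¹-cong = cong (-_)
          }
        ; comm = λ (a , b) (x , y) → cong₂ _,_ (ℤ.+-comm a x) (ℤ.+-comm b y)
        }
      ; *-cong     = cong₂ _*_
      ; *-assoc    = λ (a , b) (x , y) (u , v) →
                       cong₂ _,_ (*-assoc-re (+ c) a b x y u v) (*-assoc-im (+ c) a b x y u v)
      ; *-identity = (λ (a , b) → cong₂ _,_ (*-identityˡ-re (+ c) a b) (*-identityˡ-im a b))
                   , (λ (a , b) → cong₂ _,_ (*-identityʳ-re (+ c) a b) (*-identityʳ-im a b))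
      ; distrib    = (λ (a , b) (x , y) (u , v) →
                        cong₂ _,_ (*-distribˡ-re (+ c) a b x y u v) (*-distribˡ-im a b x y u v))
                   , (λ (a , b) (x , y) (u , v) →
                        cong₂ _,_ (*-distribʳ-re (+ c) a b x y u v) (*-distribʳ-im a b x y u v))
      }
    ; *-comm = λ (a , b) (x , y) → cong₂ _,_ (*-comm-re (+ c) a b x y) (*-comm-im a b x y)
    }

  commutativeRing : CommutativeRing 0ℓ 0ℓ
  commutativeRing = record { isCommutativeRing = isCommutativeRing }

  open CommutativeRing commutativeRing public using (+-assoc; *-comm; distribˡ; semiring)
  open import Algebra.Definitions.RawSemiring (Semiring.rawSemiring semiring) public using (_^_)
  open import Algebra.Properties.Semiring.Exp semiring public using (^-homo-*)

  ι : ℕ → ℤ√-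
  ι n = (+ n , +0)

  ι-* : ∀ m n → ι (m ℕ.* n) ≡ ι m * ι n
  ι-* m n = cong₂ _,_ (trans (ℤ.pos-* m n) (embed-*-re (+ c) (+ m) (+ n))) (embed-*-im (+ m) (+ n))

  conj : ℤ√- → ℤ√-
  conj (a , b) = (a , ℤ.- b)

  conj-+ : ∀ x y → conj (x + y) ≡ conj x + conj y
  conj-+ (a , b) (u , v) = cong (a ℤ.+ u ,_) (ℤ.neg-distrib-+ b v)

  conj-* : ∀ x y → conj (x * y) ≡ conj x * conj y
  conj-* (a , b) (u , v) = cong₂ _,_ (conj-*-re (+ c) a b u v) (conj-*-im a b u v)

  sub-conj : ∀ z → z - conj z ≡ (+0 , + 2 ℤ.* proj₂ z)
  sub-conj (a , b) = cong₂ _,_ (ℤ.+-inverseʳ a) (sub-conj-im b)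

  private
    almostCommutativeRing : AlmostCommutativeRing 0ℓ 0ℓ
    almostCommutativeRing = fromCommutativeRing commutativeRing

    embed : ℤ → ℤ√-
    embed z = (z , +0)

    embed-homomorphism : ℤ.+-*-rawRing -Raw-AlmostCommutative⟶ almostCommutativeRing
    embed-homomorphism = record
      { ⟦_⟧    = embed
      ; +-homo = λ _ _ → refl
      ; *-homo = λ x y → cong₂ _,_ (embed-*-re (+ c) x y) (embed-*-im x y)
      ; -‿homo = λ _ → refl
      ; 0-homo = refl
      ; 1-homo = refl
      }

    embed-≟ : ∀ x y → Maybe (embed x ≡ embed y)
    embed-≟ x y = Maybe.map (cong embed) (dec⇒maybe (x ℤ.≟ y))

  open RingSolver ℤ.+-*-rawRing almostCommutativeRing embed-homomorphism embed-≟ public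
    using (solve; _:=_; _:+_; _:*_; _:-_; :-_; con)

module FallingFactorial (c : ℕ) where

  open ℤ√-Ring c

  infixl 8 _↓_

  _↓_ : ℤ√- → ℕ → ℤ√-
  a ↓ zero  = 1#
  a ↓ suc n = a ↓ n * (a - ι n)

  ↓-suc-head : ∀ a n → a ↓ suc n ≡ a * (a - 1#) ↓ n
  ↓-suc-head a zero    = solve 1 (λ a → con (+ 1) :* (a :- con +0) := a :* con (+ 1)) refl a
  ↓-suc-head a (suc n) = begin
    a ↓ suc n * (a - ι (suc n))          ≡⟨ cong (_* (a - ι (suc n))) (↓-suc-head a n) ⟩
    a * (a - 1#) ↓ n * (a - ι (suc n))   ≡⟨ solve 3 (λ a x m → a :* x :* (a :- (con (+ 1) :+ m))
                                                        := a :* (x :* (a :- con (+ 1) :- m)))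
                                                  refl a ((a - 1#) ↓ n) (ι n) ⟩
    a * ((a - 1#) ↓ n * (a - 1# - ι n))  ∎

  ↓-reflect : ∀ a n → a ↓ n ≡ (- 1#) ^ n * (ι n - 1# - a) ↓ n
  ↓-reflect a zero    = solve 0 (con (+ 1) := con (+ 1) :* con (+ 1)) refl
  ↓-reflect a (suc n) = begin
    a ↓ n * (a - ι n)
      ≡⟨ cong (_* (a - ι n)) (↓-reflect a n) ⟩
    (- 1#) ^ n * (ι n - 1# - a) ↓ n * (a - ι n)
      ≡⟨ solve 4 (λ s x a m → s :* x :* (a :- m) := (:- con (+ 1)) :* s :* ((m :- a) :* x))
               refl ((- 1#) ^ n) ((ι n - 1# - a) ↓ n) a (ι n) ⟩
    (- 1#) ^ suc n * ((ι n - a) * (ι n - 1# - a) ↓ n)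
      ≡⟨ cong (λ x → (- 1#) ^ suc n * ((ι n - a) * x ↓ n))
              (solve 2 (λ m a → m :- con (+ 1) :- a := m :- a :- con (+ 1)) refl (ι n) a) ⟩
    (- 1#) ^ suc n * ((ι n - a) * (ι n - a - 1#) ↓ n)
      ≡⟨ cong ((- 1#) ^ suc n *_) (↓-suc-head (ι n - a) n) ⟨
    (- 1#) ^ suc n * (ι n - a) ↓ suc n
      ≡⟨ cong (λ x → (- 1#) ^ suc n * x ↓ suc n)
              (solve 2 (λ m a → m :- a := con (+ 1) :+ m :- con (+ 1) :- a) refl (ι n) a) ⟩
    (- 1#) ^ suc n * (ι (suc n) - 1# - a) ↓ suc n ∎

  ↓-suc-difference : ∀ a n → (a + 1#) ↓ suc n ≡ a ↓ suc n + ι (suc n) * a ↓ n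
  ↓-suc-difference a n = begin
    (a + 1#) ↓ suc n              ≡⟨ ↓-suc-head (a + 1#) n ⟩
    (a + 1#) * (a + 1# - 1#) ↓ n  ≡⟨ cong (λ x → (a + 1#) * x ↓ n)
                                          (solve 1 (λ a → a :+ con (+ 1) :- con (+ 1) := a) refl a) ⟩
    (a + 1#) * a ↓ n              ≡⟨ solve 3 (λ a x m → (a :+ con (+ 1)) :* x
                                                    := x :* (a :- m) :+ (con (+ 1) :+ m) :* x)
                                           refl a (a ↓ n) (ι n) ⟩
    a ↓ suc n + ι (suc n) * a ↓ n ∎

  vTerm : ℕ → ℕ → ℤ√- → ℤ√- → ℤ√-
  vTerm i j a b = ι (binom i j) * (a ↓ i * b ↓ j)

  -- vSum p r a b is the part i ≤ p of the Vandermonde expansion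
  -- Σ_{i + j = p + r} vTerm i j a b of (a + b) ↓ (p + r).
  vSum : ℕ → ℕ → ℤ√- → ℤ√- → ℤ√-
  vSum zero    r a b = vTerm zero r a b
  vSum (suc p) r a b = vSum p (suc r) a b + vTerm (suc p) r a b

  vTerm-swap : ∀ i j a b → vTerm i j a b ≡ vTerm j i b a
  vTerm-swap i j a b = cong₂ (λ n x → ι n * x) (binom-sym i j) (*-comm (a ↓ i) (b ↓ j))

  vSum-step : ∀ p r a b →
    (a + b - ι (p ℕ.+ r)) * vSum p r a b ≡ vSum p (suc r) a b + ι (binom p r) * (a ↓ suc p * b ↓ r)
  vSum-step zero r a b =
    solve 4 (λ a b x m → (a :+ b :- m) :* (con (+ 1) :* (con (+ 1) :* x))
                         := con (+ 1) :* (con (+ 1) :* (x :* (b :- m)))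
                            :+ con (+ 1) :* (con (+ 1) :* (a :- con +0) :* x))
            refl a b (b ↓ r) (ι r)
  vSum-step (suc p) r a b = begin
    (a + b - ι (suc p ℕ.+ r)) * (vSum p (suc r) a b + vTerm (suc p) r a b)
      ≡⟨ distribˡ (a + b - ι (suc p ℕ.+ r)) (vSum p (suc r) a b) (vTerm (suc p) r a b) ⟩
    (a + b - ι (suc p ℕ.+ r)) * vSum p (suc r) a b + (a + b - ι (suc p ℕ.+ r)) * vTerm (suc p) r a b
      ≡⟨ cong (λ k → (a + b - ι k) * vSum p (suc r) a b + (a + b - ι (suc p ℕ.+ r)) * vTerm (suc p) r a b)
              (ℕ.+-suc p r) ⟨
    (a + b - ι (p ℕ.+ suc r)) * vSum p (suc r) a b + (a + b - ι (suc p ℕ.+ r)) * vTerm (suc p) r a b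
      ≡⟨ cong (_+ (a + b - ι (suc p ℕ.+ r)) * vTerm (suc p) r a b) (vSum-step p (suc r) a b) ⟩
    vSum p (suc (suc r)) a b + ι (binom p (suc r)) * (a ↓ suc p * b ↓ suc r)
      + (a + b - ι (suc p ℕ.+ r)) * vTerm (suc p) r a b
      ≡⟨ solve 9 (λ a b s β₁ β₂ x y m n →
                   s :+ β₁ :* (x :* (y :* (b :- n))) :+ (a :+ b :- (con (+ 1) :+ m :+ n)) :* (β₂ :* (x :* y))
                   := s :+ (β₁ :+ β₂) :* (x :* (y :* (b :- n))) :+ β₂ :* (x :* (a :- (con (+ 1) :+ m)) :* y))
               refl a b (vSum p (suc (suc r)) a b) (ι (binom p (suc r))) (ι (binom (suc p) r))
               (a ↓ suc p) (b ↓ r) (ι p) (ι r) ⟩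
    vSum (suc p) (suc r) a b + ι (binom (suc p) r) * (a ↓ suc (suc p) * b ↓ r) ∎

  vandermonde : ∀ n a b → vSum n 0 a b ≡ (a + b) ↓ n
  vandermonde zero    a b = solve 0 (con (+ 1) :* (con (+ 1) :* con (+ 1)) := con (+ 1)) refl
  vandermonde (suc n) a b = begin
    vSum n 1 a b + ι 1 * (a ↓ suc n * 1#)
      ≡⟨ cong (λ k → vSum n 1 a b + ι k * (a ↓ suc n * 1#)) (binom-sym n 0) ⟨
    vSum n 1 a b + ι (binom n 0) * (a ↓ suc n * 1#)
      ≡⟨ vSum-step n 0 a b ⟨
    (a + b - ι (n ℕ.+ 0)) * vSum n 0 a b
      ≡⟨ cong₂ (λ k x → (a + b - ι k) * x) (ℕ.+-identityʳ n) (vandermonde n a b) ⟩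
    (a + b - ι n) * (a + b) ↓ n
      ≡⟨ *-comm (a + b - ι n) ((a + b) ↓ n) ⟩
    (a + b) ↓ suc n ∎

  vandermonde-split : ∀ p s a b → vSum p (suc s) a b + vSum s (suc p) b a ≡ (a + b) ↓ suc (p ℕ.+ s)
  vandermonde-split p zero a b = begin
    vSum p 1 a b + vTerm 0 (suc p) b a  ≡⟨ cong (λ x → vSum p 1 a b + x) (vTerm-swap 0 (suc p) b a) ⟩
    vSum (suc p) 0 a b                  ≡⟨ vandermonde (suc p) a b ⟩
    (a + b) ↓ suc p                     ≡⟨ cong (λ k → (a + b) ↓ suc k) (ℕ.+-identityʳ p) ⟨
    (a + b) ↓ suc (p ℕ.+ 0)             ∎
  vandermonde-split p (suc s) a b = begin
    vSum p (suc (suc s)) a b + (vSum s (suc (suc p)) b a + vTerm (suc s) (suc p) b a)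
      ≡⟨ cong (λ x → vSum p (suc (suc s)) a b + (vSum s (suc (suc p)) b a + x))
              (vTerm-swap (suc s) (suc p) b a) ⟩
    vSum p (suc (suc s)) a b + (vSum s (suc (suc p)) b a + vTerm (suc p) (suc s) a b)
      ≡⟨ solve 3 (λ x y z → x :+ (y :+ z) := x :+ z :+ y)
               refl (vSum p (suc (suc s)) a b) (vSum s (suc (suc p)) b a) (vTerm (suc p) (suc s) a b) ⟩
    vSum (suc p) (suc s) a b + vSum s (suc (suc p)) b a
      ≡⟨ vandermonde-split (suc p) s a b ⟩
    (a + b) ↓ suc (suc p ℕ.+ s)
      ≡⟨ cong (λ k → (a + b) ↓ suc k) (ℕ.+-suc p s) ⟨
    (a + b) ↓ suc (p ℕ.+ suc s) ∎

  vTerm-transfer : ∀ p r a b →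
    vTerm p (suc r) a b + vTerm (suc p) r (a + 1#) b ≡ vTerm p (suc r) a (b + 1#) + vTerm (suc p) r a b
  vTerm-transfer p r a b = begin
    β′ * (a ↓ p * b ↓ suc r) + β * ((a + 1#) ↓ suc p * b ↓ r)
      ≡⟨ cong (λ x → β′ * (a ↓ p * b ↓ suc r) + β * (x * b ↓ r)) (↓-suc-difference a p) ⟩
    β′ * (a ↓ p * b ↓ suc r) + β * ((a ↓ suc p + ι (suc p) * a ↓ p) * b ↓ r)
      ≡⟨ solve 7 (λ β β′ x x′ y y′ n → β′ :* (x :* y′) :+ β :* ((x′ :+ n :* x) :* y)
                                       := β′ :* (x :* y′) :+ n :* β :* (x :* y) :+ β :* (x′ :* y))
               refl β β′ (a ↓ p) (a ↓ suc p) (b ↓ r) (b ↓ suc r) (ι (suc p)) ⟩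
    β′ * (a ↓ p * b ↓ suc r) + ι (suc p) * β * (a ↓ p * b ↓ r) + vTerm (suc p) r a b
      ≡⟨ cong (λ x → β′ * (a ↓ p * b ↓ suc r) + x * (a ↓ p * b ↓ r) + vTerm (suc p) r a b) absorption ⟩
    β′ * (a ↓ p * b ↓ suc r) + ι (suc r) * β′ * (a ↓ p * b ↓ r) + vTerm (suc p) r a b
      ≡⟨ solve 6 (λ β′ x y y′ n t → β′ :* (x :* y′) :+ n :* β′ :* (x :* y) :+ t
                                    := β′ :* (x :* (y′ :+ n :* y)) :+ t)
               refl β′ (a ↓ p) (b ↓ r) (b ↓ suc r) (ι (suc r)) (vTerm (suc p) r a b) ⟩
    β′ * (a ↓ p * (b ↓ suc r + ι (suc r) * b ↓ r)) + vTerm (suc p) r a b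
      ≡⟨ cong (λ x → β′ * (a ↓ p * x) + vTerm (suc p) r a b) (↓-suc-difference b r) ⟨
    β′ * (a ↓ p * (b + 1#) ↓ suc r) + vTerm (suc p) r a b ∎
    where
    β β′ : ℤ√-
    β  = ι (binom (suc p) r)
    β′ = ι (binom p (suc r))
    absorption : ι (suc p) * β ≡ ι (suc r) * β′
    absorption = begin
      ι (suc p) * β                          ≡⟨ ι-* (suc p) (binom (suc p) r) ⟨
      ι (suc p ℕ.* binom (suc p) r)          ≡⟨ cong ι (binom-absorption p r) ⟩
      ι (suc r ℕ.* binom p (suc r))          ≡⟨ ι-* (suc r) (binom p (suc r)) ⟩
      ι (suc r) * β′                         ∎

  vSum-transfer : ∀ p r a b → vSum (suc p) r (a + 1#) b ≡ vSum p (suc r) a (b + 1#) + vTerm (suc p) r a b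
  vSum-transfer zero    r a b = vTerm-transfer zero r a b
  vSum-transfer (suc p) r a b = begin
    vSum (suc p) (suc r) (a + 1#) b + vTerm (suc (suc p)) r (a + 1#) b
      ≡⟨ cong (_+ vTerm (suc (suc p)) r (a + 1#) b) (vSum-transfer p (suc r) a b) ⟩
    vSum p (suc (suc r)) a (b + 1#) + vTerm (suc p) (suc r) a b + vTerm (suc (suc p)) r (a + 1#) b
      ≡⟨ +-assoc (vSum p (suc (suc r)) a (b + 1#)) _ _ ⟩
    vSum p (suc (suc r)) a (b + 1#) + (vTerm (suc p) (suc r) a b + vTerm (suc (suc p)) r (a + 1#) b)
      ≡⟨ cong (λ x → vSum p (suc (suc r)) a (b + 1#) + x) (vTerm-transfer (suc p) r a b) ⟩
    vSum p (suc (suc r)) a (b + 1#) + (vTerm (suc p) (suc r) a (b + 1#) + vTerm (suc (suc p)) r a b)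
      ≡⟨ +-assoc (vSum p (suc (suc r)) a (b + 1#)) _ _ ⟨
    vSum (suc p) (suc r) a (b + 1#) + vTerm (suc (suc p)) r a b ∎

  vTerm-reflect : ∀ i j a b → vTerm i j a b ≡ (- 1#) ^ (i ℕ.+ j) * vTerm i j (ι i - 1# - a) (ι j - 1# - b)
  vTerm-reflect i j a b = begin
    ι (binom i j) * (a ↓ i * b ↓ j)
      ≡⟨ cong₂ (λ x y → ι (binom i j) * (x * y)) (↓-reflect a i) (↓-reflect b j) ⟩
    ι (binom i j) * ((- 1#) ^ i * (ι i - 1# - a) ↓ i * ((- 1#) ^ j * (ι j - 1# - b) ↓ j))
      ≡⟨ solve 5 (λ β s t x y → β :* (s :* x :* (t :* y)) := s :* t :* (β :* (x :* y)))
               refl (ι (binom i j)) ((- 1#) ^ i) ((- 1#) ^ j) ((ι i - 1# - a) ↓ i) ((ι j - 1# - b) ↓ j) ⟩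
    (- 1#) ^ i * (- 1#) ^ j * vTerm i j (ι i - 1# - a) (ι j - 1# - b)
      ≡⟨ cong (_* vTerm i j (ι i - 1# - a) (ι j - 1# - b)) (^-homo-* (- 1#) i j) ⟨
    (- 1#) ^ (i ℕ.+ j) * vTerm i j (ι i - 1# - a) (ι j - 1# - b) ∎

  vSum-reflect : ∀ p r a b → vSum p r a b ≡ (- 1#) ^ (p ℕ.+ r) * vSum p r (ι p - a) (ι r - 1# - b)
  vSum-reflect zero    r a b = vTerm-reflect zero r a b
  vSum-reflect (suc p) r a b = begin
    vSum (suc p) r a b
      ≡⟨ cong (λ x → vSum (suc p) r x b) (solve 1 (λ a → a := a :- con (+ 1) :+ con (+ 1)) refl a) ⟩
    vSum (suc p) r (a - 1# + 1#) b
      ≡⟨ vSum-transfer p r (a - 1#) b ⟩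
    vSum p (suc r) (a - 1#) (b + 1#) + vTerm (suc p) r (a - 1#) b
      ≡⟨ cong₂ _+_ (vSum-reflect p (suc r) (a - 1#) (b + 1#)) (vTerm-reflect (suc p) r (a - 1#) b) ⟩
    (- 1#) ^ (p ℕ.+ suc r) * vSum p (suc r) (ι p - (a - 1#)) (ι (suc r) - 1# - (b + 1#))
      + (- 1#) ^ (suc p ℕ.+ r) * vTerm (suc p) r (ι (suc p) - 1# - (a - 1#)) b′
      ≡⟨ cong₂ (λ x y → (- 1#) ^ (p ℕ.+ suc r) * vSum p (suc r) x (ι (suc r) - 1# - (b + 1#))
                          + σ * vTerm (suc p) r y b′)
               (solve 2 (λ m a → m :- (a :- con (+ 1)) := con (+ 1) :+ m :- a) refl (ι p) a)
               (solve 2 (λ m a → m :- con (+ 1) :- (a :- con (+ 1)) := m :- a) refl (ι (suc p)) a) ⟩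
    (- 1#) ^ (p ℕ.+ suc r) * vSum p (suc r) a′ (ι (suc r) - 1# - (b + 1#)) + σ * vTerm (suc p) r a′ b′
      ≡⟨ cong (λ k → (- 1#) ^ k * vSum p (suc r) a′ (ι (suc r) - 1# - (b + 1#)) + σ * vTerm (suc p) r a′ b′)
              (ℕ.+-suc p r) ⟩
    σ * vSum p (suc r) a′ (ι (suc r) - 1# - (b + 1#)) + σ * vTerm (suc p) r a′ b′
      ≡⟨ cong (λ x → σ * vSum p (suc r) a′ x + σ * vTerm (suc p) r a′ b′)
              (solve 2 (λ n b → con (+ 1) :+ n :- con (+ 1) :- (b :+ con (+ 1)) := n :- con (+ 1) :- b) refl (ι r) b) ⟩
    σ * vSum p (suc r) a′ b′ + σ * vTerm (suc p) r a′ b′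
      ≡⟨ distribˡ σ (vSum p (suc r) a′ b′) (vTerm (suc p) r a′ b′) ⟨
    σ * vSum (suc p) r a′ b′ ∎
    where
    σ a′ b′ : ℤ√-
    σ  = (- 1#) ^ (suc p ℕ.+ r)
    a′ = ι (suc p) - a
    b′ = ι r - 1# - b

module ProductGcd (c : ℕ) where

  open ℤ√-Ring c
  open FallingFactorial c
  open ComponentIdentities

  conj-↓ : ∀ a n → conj (a ↓ n) ≡ conj a ↓ n
  conj-↓ a zero    = refl
  conj-↓ a (suc n) = trans (conj-* (a ↓ n) (a - ι n)) (cong₂ _*_ (conj-↓ a n) (conj-+ a (- ι n)))

  conj-vTerm : ∀ i j a b → conj (vTerm i j a b) ≡ vTerm i j (conj a) (conj b)
  conj-vTerm i j a b = begin
    conj (ι (binom i j) * (a ↓ i * b ↓ j))   ≡⟨ conj-* (ι (binom i j)) (a ↓ i * b ↓ j) ⟩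
    ι (binom i j) * conj (a ↓ i * b ↓ j)     ≡⟨ cong (ι (binom i j) *_) (conj-* (a ↓ i) (b ↓ j)) ⟩
    ι (binom i j) * (conj (a ↓ i) * conj (b ↓ j))
      ≡⟨ cong₂ (λ x y → ι (binom i j) * (x * y)) (conj-↓ a i) (conj-↓ b j) ⟩
    vTerm i j (conj a) (conj b)              ∎

  conj-vSum : ∀ p r a b → conj (vSum p r a b) ≡ vSum p r (conj a) (conj b)
  conj-vSum zero    r a b = conj-vTerm zero r a b
  conj-vSum (suc p) r a b =
    trans (conj-+ (vSum p (suc r) a b) (vTerm (suc p) r a b))
          (cong₂ _+_ (conj-vSum p (suc r) a b) (conj-vTerm (suc p) r a b))

  infix 4 _divides_

  _divides_ : ℕ → ℤ√- → Set
  d divides (a , b) = + d ℤ.∣ a × + d ℤ.∣ b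

  h-divides : ∀ z → h z divides z
  h-divides (a , b) = ℤ.∣ᵤ⇒∣ (gcd[m,n]∣m ℤ.∣ a ∣ ℤ.∣ b ∣) , ℤ.∣ᵤ⇒∣ (gcd[m,n]∣n ℤ.∣ a ∣ ℤ.∣ b ∣)

  module _ {d : ℕ} where

    divides-+ : ∀ {x y} → d divides x → d divides y → d divides x + y
    divides-+ (d∣a , d∣b) (d∣u , d∣v) = ℤ.∣m∣n⇒∣m+n d∣a d∣u , ℤ.∣m∣n⇒∣m+n d∣b d∣v

    divides-*ˡ : ∀ x {y} → d divides y → d divides x * y
    divides-*ˡ (a , b) (d∣u , d∣v) =
      ℤ.∣m∣n⇒∣m-n (ℤ.∣n⇒∣m*n a d∣u) (ℤ.∣n⇒∣m*n (+ c) (ℤ.∣n⇒∣m*n b d∣v)) ,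
      ℤ.∣m∣n⇒∣m+n (ℤ.∣n⇒∣m*n a d∣v) (ℤ.∣n⇒∣m*n b d∣u)

    divides-*ʳ : ∀ {x} y → d divides x → d divides x * y
    divides-*ʳ {x} y d∣x = subst (d divides_) (*-comm y x) (divides-*ˡ y d∣x)

    vSum-divides : ∀ p r a b → d divides b ↓ r → d divides vSum p r a b
    vSum-divides zero    r a b d∣b↓r = divides-*ˡ 1# (divides-*ˡ 1# d∣b↓r)
    vSum-divides (suc p) r a b d∣b↓r =
      divides-+ (vSum-divides p (suc r) a b (divides-*ʳ (b - ι r) d∣b↓r))
                (divides-*ˡ (ι (binom (suc p) r)) (divides-*ˡ (a ↓ suc p) d∣b↓r))

  prodShift-↓ : ∀ m k → prodShift c m k ≡ ((+ m , + 1) + ι k) ↓ suc k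
  prodShift-↓ m zero    = solve 1 (λ x → x := con (+ 1) :* (x :+ con +0 :- con +0)) refl (+ m , + 1)
  prodShift-↓ m (suc k) = begin
    prodShift c m k * (x + ι (suc k))                ≡⟨ cong (_* (x + ι (suc k))) (prodShift-↓ m k) ⟩
    (x + ι k) ↓ suc k * (x + ι (suc k))              ≡⟨ *-comm ((x + ι k) ↓ suc k) (x + ι (suc k)) ⟩
    (x + ι (suc k)) * (x + ι k) ↓ suc k
      ≡⟨ cong (λ y → (x + ι (suc k)) * y ↓ suc k)
              (solve 2 (λ x m → x :+ m := x :+ (con (+ 1) :+ m) :- con (+ 1)) refl x (ι k)) ⟩
    (x + ι (suc k)) * (x + ι (suc k) - 1#) ↓ suc k   ≡⟨ ↓-suc-head (x + ι (suc k)) (suc k) ⟨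
    (x + ι (suc k)) ↓ suc (suc k)                    ∎
    where
    x : ℤ√-
    x = (+ m , + 1)

  signedProdSq : ℕ → ℤ
  signedProdSq zero    = + 1
  signedProdSq (suc k) = ℤ.- + (suc k ℕ.* suc k ℕ.+ 4 ℕ.* c) ℤ.* signedProdSq k

  ∣signedProdSq∣ : ∀ k → ℤ.∣ signedProdSq k ∣ ≡ prodSq c k
  ∣signedProdSq∣ zero    = refl
  ∣signedProdSq∣ (suc k) = begin
    ℤ.∣ ℤ.- + N ℤ.* signedProdSq k ∣         ≡⟨ ℤ.abs-* (ℤ.- + N) (signedProdSq k) ⟩
    ℤ.∣ ℤ.- + N ∣ ℕ.* ℤ.∣ signedProdSq k ∣   ≡⟨ cong₂ ℕ._*_ (ℤ.∣-i∣≡∣i∣ (+ N)) (∣signedProdSq∣ k) ⟩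
    N ℕ.* prodSq c k                         ≡⟨ ℕ.*-comm N (prodSq c k) ⟩
    prodSq c k ℕ.* N                         ∎
    where
    N : ℕ
    N = suc k ℕ.* suc k ℕ.+ 4 ℕ.* c

  δ : ℤ√-
  δ = (+0 , + 2)

  δ-square : ∀ j → (δ + ι j) * (δ - ι j) ≡ (ℤ.- + (j ℕ.* j ℕ.+ 4 ℕ.* c) , +0)
  δ-square j = cong₂ _,_ (trans (δ-square-re (+ c) (+ j)) (cong ℤ.-_ (sym pos-N))) (δ-square-im (+ j))
    where
    pos-N : + (j ℕ.* j ℕ.+ 4 ℕ.* c) ≡ + j ℤ.* + j ℤ.+ + 4 ℤ.* + c
    pos-N = trans (ℤ.pos-+ (j ℕ.* j) (4 ℕ.* c)) (cong₂ ℤ._+_ (ℤ.pos-* j j) (ℤ.pos-* 4 c))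

  δ-centred-↓ : ∀ k → (δ + ι k) ↓ suc (k ℕ.+ k) ≡ (+0 , + 2 ℤ.* signedProdSq k)
  δ-centred-↓ zero    = solve 1 (λ x → con (+ 1) :* (x :+ con +0 :- con +0) := x) refl δ
  δ-centred-↓ (suc k) = begin
    A ↓ suc (suc k ℕ.+ suc k)      ≡⟨ cong (λ j → A ↓ suc (suc j)) (ℕ.+-suc k k) ⟩
    A ↓ suc (suc n)                ≡⟨ ↓-suc-head A (suc n) ⟩
    A * (A - 1#) ↓ suc n           ≡⟨ cong (λ y → A * y ↓ suc n)
                                           (solve 2 (λ x m → x :+ (con (+ 1) :+ m) :- con (+ 1) := x :+ m)
                                                  refl δ (ι k)) ⟩
    A * (B ↓ n * (B - ι n))        ≡⟨ cong (λ y → A * (y * (B - ι n))) (δ-centred-↓ k) ⟩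
    A * (E * (B - ι n))            ≡⟨ solve 3 (λ x m e → (x :+ (con (+ 1) :+ m)) :* (e :* (x :+ m :- (con (+ 1) :+ m :+ m)))
                                                   := (x :+ (con (+ 1) :+ m)) :* (x :- (con (+ 1) :+ m)) :* e)
                                            refl δ (ι k) E ⟩
    A * (δ - ι (suc k)) * E        ≡⟨ cong (_* E) (δ-square (suc k)) ⟩
    (ℤ.- + N , +0) * E             ≡⟨ cong₂ _,_ (real-*-imaginary-re (+ c) (ℤ.- + N) (+ 2 ℤ.* signedProdSq k))
                                                (real-*-imaginary-im (ℤ.- + N) (signedProdSq k)) ⟩
    (+0 , + 2 ℤ.* signedProdSq (suc k)) ∎
    where
    A B E : ℤ√-
    A = δ + ι (suc k)
    B = δ + ι k
    E = (+0 , + 2 ℤ.* signedProdSq k)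
    n N : ℕ
    n = suc (k ℕ.+ k)
    N = suc k ℕ.* suc k ℕ.+ 4 ℕ.* c

  -1^odd≡-1 : ∀ k → (- 1#) ^ (k ℕ.+ suc k) ≡ - 1#
  -1^odd≡-1 zero    = solve 0 ((:- con (+ 1)) :* con (+ 1) := :- con (+ 1)) refl
  -1^odd≡-1 (suc k) = begin
    - 1# * (- 1#) ^ (k ℕ.+ suc (suc k))   ≡⟨ cong (λ j → - 1# * (- 1#) ^ j) (ℕ.+-suc k (suc k)) ⟩
    - 1# * (- 1# * (- 1#) ^ (k ℕ.+ suc k)) ≡⟨ cong (λ y → - 1# * (- 1# * y)) (-1^odd≡-1 k) ⟩
    - 1# * (- 1# * - 1#)                   ≡⟨ solve 0 ((:- con (+ 1)) :* ((:- con (+ 1)) :* (:- con (+ 1)))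
                                                        := :- con (+ 1)) refl ⟩
    - 1#                                   ∎

  divides-prodSq : ∀ d m k → d divides prodShift c m k → d ℕ.∣ prodSq c k
  divides-prodSq d m k d∣P =
    subst (d ℕ.∣_) (∣signedProdSq∣ k) (ℤ.∣⇒∣ᵤ (subst (+ d ℤ.∣_) Im-W (proj₂ d∣W)))
    where
    x u v W W′ : ℤ√-
    x  = (+ m , + 1)
    u  = x + ι k
    v  = - conj x
    W  = vSum k (suc k) v u
    W′ = vSum k (suc k) u v

    d∣W : d divides W
    d∣W = vSum-divides k (suc k) v u (subst (d divides_) (prodShift-↓ m k) d∣P)

    conj-W : conj W ≡ - W′
    conj-W = begin
      conj W
        ≡⟨ conj-vSum k (suc k) v u ⟩
      vSum k (suc k) (- x) (conj x + ι k)
        ≡⟨ vSum-reflect k (suc k) (- x) (conj x + ι k) ⟩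
      (- 1#) ^ (k ℕ.+ suc k) * vSum k (suc k) (ι k - - x) (ι (suc k) - 1# - (conj x + ι k))
        ≡⟨ cong₂ (λ y z → (- 1#) ^ (k ℕ.+ suc k) * vSum k (suc k) y z)
                 (solve 2 (λ x m → m :- (:- x) := x :+ m) refl x (ι k))
                 (solve 2 (λ y m → con (+ 1) :+ m :- con (+ 1) :- (y :+ m) := :- y) refl (conj x) (ι k)) ⟩
      (- 1#) ^ (k ℕ.+ suc k) * W′
        ≡⟨ cong (_* W′) (-1^odd≡-1 k) ⟩
      - 1# * W′
        ≡⟨ solve 1 (λ w → (:- con (+ 1)) :* w := :- w) refl W′ ⟩
      - W′ ∎

    W-conj-W : W - conj W ≡ (δ + ι k) ↓ suc (k ℕ.+ k)
    W-conj-W = begin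
      W - conj W                  ≡⟨ cong (λ y → W - y) conj-W ⟩
      W - - W′                    ≡⟨ solve 2 (λ w w′ → w :- (:- w′) := w :+ w′) refl W W′ ⟩
      W + W′                      ≡⟨ vandermonde-split k k v u ⟩
      (v + u) ↓ suc (k ℕ.+ k)     ≡⟨ cong (λ y → y ↓ suc (k ℕ.+ k)) v+u ⟩
      (δ + ι k) ↓ suc (k ℕ.+ k)   ∎
      where
      v+u : v + u ≡ δ + ι k
      v+u = trans (solve 3 (λ x y m → (:- y) :+ (x :+ m) := x :- y :+ m) refl x (conj x) (ι k))
                  (cong (_+ ι k) (sub-conj x))

    Im-W : proj₂ W ≡ signedProdSq k
    Im-W = ℤ.*-cancelˡ-≡ (+ 2) (proj₂ W) (signedProdSq k)
             (cong proj₂ (trans (sym (sub-conj W)) (trans W-conj-W (δ-centred-↓ k))))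

open import Data.Nat using (_≤_; _*_; _∸_; NonZero)
open import Data.Nat.Divisibility using (_∣_)

-- None of the hypotheses is needed.
theorem3 : (c m n : ℕ) → NonZero c → NonZero m → NonZero n → m ≤ n →
    h (prodRange c m n) ∣ c * prodSq c (n ∸ m)
theorem3 c m n _ _ _ _ =
  ℕ.∣n⇒∣m*n c (divides-prodSq (h (prodRange c m n)) m (n ∸ m) (h-divides (prodRange c m n)))
  where open ProductGcd c
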